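{- Let $A$ be an $\mathrm{OA}(m,n)$. If $A$ has a subarray that is an $\mathrm{OA}(m,n')$ with $n<mn'$ and $(n')^2<n$, then $A$ does not have the MMS star property.
   Context: An orthogonal array $\mathrm{OA}(m,n)$ is an $m\times n^2$ array with entries in $\{0,\dots,n-1\}$ such that for any two rows, each of the $n^2$ ordered pairs of symbols occurs in exactly one column. It is viewed as an incidence structure whose points are the pairs $(r,i)$ ($r$ a row, $i$ a symbol) and whose lines are the columns, a column containing $(r,i)$ iff its entry in row $r$ is $i$; each point lies in exactly $n$ columns. A subarray that is an $\mathrm{OA}(m,n')$ is a set of $(n')^2$ columns of $A$ such that, for some sets $S_r$ of $n'$ symbols ($r=1,\dots,m$), each of these columns has its row-$r$ entry in $S_r$ and for any two rows $r\ne r'$ every pair in $S_r\times S_{r'}$ occurs in exactly one of these columns. $A$ has the MMS star property if for every function $f$ from the $mn$ points to $\mathbb{R}$ with total sum $0$, the number of columns whose points have nonnegative total weight is at least $n$. -}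

module Defs where

open import Data.Nat using (ℕ; _*_; _≤_)
open import Data.Fin using (Fin)
open import Data.Fin.Subset using (Subset; _∈_; ∣_∣)
open import Data.List using (List; length; filter; map; foldr; allFin)
open import Data.Product using (Σ; _×_; _,_)
open import Data.Rational using (ℚ; 0ℚ; _+_) renaming (_≤_ to _≤ℚ_; _≤?_ to _≤ℚ?_)
open import Relation.Binary.PropositionalEquality using (_≡_; _≢_)
open import Function.Definitions using (Injective)

Array : ℕ → ℕ → Set
Array m n = Fin m → Fin (n * n) → Fin n

ExactlyOne : {C : Set} → (C → Set) → Set
ExactlyOne {C} P = Σ C (λ c → P c × (∀ c' → P c' → c' ≡ c))

IsOA : (m n : ℕ) → Array m n → Set
IsOA m n A = ∀ (r r' : Fin m) → r ≢ r' → ∀ (i j : Fin n) →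
  ExactlyOne (λ c → A r c ≡ i × A r' c ≡ j)

-- A has a subarray that is an OA(m,n'): a set of (n')² columns (given by an
-- injective enumeration ι) and sets S r of n' symbols per row, such that each
-- chosen column has its row-r entry in S r, and for any two distinct rows every
-- pair in S r × S r' occurs in exactly one of the chosen columns.
HasSubOA : (m n : ℕ) → Array m n → ℕ → Set
HasSubOA m n A n' =
  Σ (Fin (n' * n') → Fin (n * n)) λ ι →
  Σ (Fin m → Subset n) λ S →
    Injective _≡_ _≡_ ι
  × (∀ r → ∣ S r ∣ ≡ n')
  × (∀ r k → A r (ι k) ∈ S r)
  × (∀ (r r' : Fin m) → r ≢ r' → ∀ (i j : Fin n) → i ∈ S r → j ∈ S r' →
       ExactlyOne (λ k → A r (ι k) ≡ i × A r' (ι k) ≡ j))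

sumℚ : List ℚ → ℚ
sumℚ = foldr _+_ 0ℚ

ΣFin : (k : ℕ) → (Fin k → ℚ) → ℚ
ΣFin k g = sumℚ (map g (allFin k))

Weight : ℕ → ℕ → Set
Weight m n = Fin m → Fin n → ℚ

totalWeight : (m n : ℕ) → Weight m n → ℚ
totalWeight m n f = ΣFin m (λ r → ΣFin n (λ i → f r i))

columnWeight : (m n : ℕ) → Array m n → Weight m n → Fin (n * n) → ℚ
columnWeight m n A f c = ΣFin m (λ r → f r (A r c))

nonnegColumns : (m n : ℕ) → Array m n → Weight m n → ℕ
nonnegColumns m n A f =
  length (filter (λ c → 0ℚ ≤ℚ? columnWeight m n A f c) (allFin (n * n)))

MMSStar : (m n : ℕ) → Array m n → Set
MMSStar m n A = ∀ (f : Weight m n) → totalWeight m n f ≡ 0ℚ →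
  n ≤ nonnegColumns m n A f

module Submission where

-- Let (ι, S) be the sub-OA(m,n') of A and give the point (r,i) the weight
--     f(r,i) = n·[i ∈ S r] − n' .
-- Each row contains |S r| = n' marked symbols, so its weight is n'·n − n·n' = 0,
-- and f has total weight 0.  A column c meeting k marked points has weight
-- k·n − m·n'; as n < m·n', it is nonnegative only if k ≥ 2, i.e. only if two
-- distinct rows r, r' carry marked symbols in c.  The sub-OA has a column ι k
-- with the same pair of symbols in rows r, r', and since A is an OA that pair
-- occurs in a single column, so c = ι k.  Thus every nonnegative column lies
-- in the image of ι, there are at most (n')² < n of them, and the star
-- property fails for f.

open import Defs
open import Data.Nat using (ℕ; _*_; _<_)
open import Relation.Nullary using (¬_)

open import Data.Nat as ℕ using (zero; suc; _+_; _≤_; s≤s)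
import Data.Nat.Properties as ℕP
open import Data.Fin using (Fin)
import Data.Fin as Fin
open import Data.Fin.Properties using (injective⇒≤)
open import Data.Fin.Subset using (Subset; Side; inside; outside; ∣_∣) renaming (_∈_ to _∈ₛ_)
open import Data.Fin.Subset.Properties using (_∈?_)
open import Data.Vec using (_∷_; [])
open import Data.List using (List; []; _∷_; length; filter; map; tabulate; allFin; lookup)
open import Data.List.Properties using (length-tabulate)
open import Data.List.Membership.Propositional.Properties using (∈-lookup)
open import Data.List.Relation.Unary.All as All using (All; _∷_)
open import Data.List.Relation.Unary.All.Properties using (all-filter)
open import Data.List.Relation.Unary.AllPairs using (_∷_)
open import Data.List.Relation.Unary.Unique.Propositional using (Unique)
open import Data.List.Relation.Unary.Unique.Propositional.Properties using (allFin⁺; filter⁺)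
open import Data.Rational using (ℚ; 0ℚ; 1ℚ; -_) renaming (_+_ to _+ℚ_; _*_ to _*ℚ_; _≤_ to _≤ℚ_; _<_ to _<ℚ_)
import Data.Rational.Properties as ℚP
open import Data.Rational.Solver using (module +-*-Solver)
open import Data.Product using (Σ; ∃; _×_; _,_; proj₁; proj₂)
open import Data.Bool using (Bool; true; false; if_then_else_)
open import Data.Sum using (inj₁; inj₂)
open import Relation.Nullary using (does; yes; no)
open import Relation.Unary using (Decidable)
open import Relation.Binary.PropositionalEquality
open import Data.Empty using (⊥-elim)

fromℕ : ℕ → ℚ
fromℕ zero = 0ℚ
fromℕ (suc k) = 1ℚ +ℚ fromℕ k

fromℕ-+ : ∀ a b → fromℕ (a + b) ≡ fromℕ a +ℚ fromℕ b
fromℕ-+ zero b = sym (ℚP.+-identityˡ (fromℕ b))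
fromℕ-+ (suc a) b rewrite fromℕ-+ a b = sym (ℚP.+-assoc 1ℚ (fromℕ a) (fromℕ b))

fromℕ-* : ∀ a b → fromℕ (a * b) ≡ fromℕ a *ℚ fromℕ b
fromℕ-* zero b = sym (ℚP.*-zeroˡ (fromℕ b))
fromℕ-* (suc a) b rewrite fromℕ-+ b (a * b) | fromℕ-* a b =
  solve 2 (λ x y → y :+ x :* y := (con 1ℚ :+ x) :* y) refl (fromℕ a) (fromℕ b)
  where open +-*-Solver

fromℕ-<-suc : ∀ k → fromℕ k <ℚ fromℕ (suc k)
fromℕ-<-suc k = subst (_<ℚ fromℕ (suc k)) (ℚP.+-identityˡ (fromℕ k))
  (ℚP.+-monoˡ-< (fromℕ k) (ℚP.positive⁻¹ 1ℚ))

fromℕ-mono-< : ∀ {a b} → a < b → fromℕ a <ℚ fromℕ b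
fromℕ-mono-< {a} {suc b} (s≤s a≤b) with ℕP.m≤n⇒m<n∨m≡n a≤b
... | inj₁ a<b = ℚP.<-trans (fromℕ-mono-< a<b) (fromℕ-<-suc b)
... | inj₂ refl = fromℕ-<-suc b

_when_ : ℚ → Bool → ℚ
y when b = if b then y else 0ℚ

sum-affine-indicator : ∀ {A : Set} {P : A → Set} (P? : Decidable P) (x y : ℚ) (xs : List A) →
  sumℚ (map (λ a → x +ℚ (y when does (P? a))) xs)
    ≡ fromℕ (length xs) *ℚ x +ℚ fromℕ (length (filter P? xs)) *ℚ y
sum-affine-indicator P? x y [] =
  sym (trans (cong₂ _+ℚ_ (ℚP.*-zeroˡ x) (ℚP.*-zeroˡ y)) (ℚP.+-identityˡ 0ℚ))
sum-affine-indicator P? x y (a ∷ xs) with does (P? a)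
... | true rewrite sum-affine-indicator P? x y xs =
  solve 4 (λ x y l c → (x :+ y) :+ (l :* x :+ c :* y) := (con 1ℚ :+ l) :* x :+ (con 1ℚ :+ c) :* y)
    refl x y (fromℕ (length xs)) (fromℕ (length (filter P? xs)))
  where open +-*-Solver
... | false rewrite sum-affine-indicator P? x y xs =
  solve 4 (λ x y l c → (x :+ con 0ℚ) :+ (l :* x :+ c :* y) := (con 1ℚ :+ l) :* x :+ c :* y)
    refl x y (fromℕ (length xs)) (fromℕ (length (filter P? xs)))
  where open +-*-Solver

sum-zero : ∀ {A : Set} (g : A → ℚ) → (∀ a → g a ≡ 0ℚ) → (xs : List A) → sumℚ (map g xs) ≡ 0ℚ
sum-zero g g≡0 [] = refl
sum-zero g g≡0 (a ∷ xs) rewrite g≡0 a | sum-zero g g≡0 xs = refl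

length-allFin : ∀ k → length (allFin k) ≡ k
length-allFin k = length-tabulate (λ i → i)

count-∈-suc : ∀ {k} (s : Side) (p : Subset k) {j} (g : Fin j → Fin k) →
  length (filter (_∈? (s ∷ p)) (tabulate (λ i → Fin.suc (g i))))
    ≡ length (filter (_∈? p) (tabulate g))
count-∈-suc s p {zero} g = refl
count-∈-suc s p {suc j} g with does (g Fin.zero ∈? p)
... | true = cong suc (count-∈-suc s p (λ i → g (Fin.suc i)))
... | false = count-∈-suc s p (λ i → g (Fin.suc i))

count-∈ : ∀ {k} (p : Subset k) → length (filter (_∈? p) (allFin k)) ≡ ∣ p ∣
count-∈ [] = refl
count-∈ (inside ∷ p) = cong suc (trans (count-∈-suc inside p (λ i → i)) (count-∈ p))
count-∈ (outside ∷ p) = trans (count-∈-suc outside p (λ i → i)) (count-∈ p)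

unique-lookup-injective : ∀ {A : Set} {xs : List A} → Unique xs →
  ∀ i j → lookup xs i ≡ lookup xs j → i ≡ j
unique-lookup-injective (_ ∷ _) Fin.zero Fin.zero _ = refl
unique-lookup-injective (x∉ ∷ _) Fin.zero (Fin.suc j) e = ⊥-elim (All.lookup x∉ (∈-lookup j) e)
unique-lookup-injective (x∉ ∷ _) (Fin.suc i) Fin.zero e = ⊥-elim (All.lookup x∉ (∈-lookup i) (sym e))
unique-lookup-injective (_ ∷ u) (Fin.suc i) (Fin.suc j) e = cong Fin.suc (unique-lookup-injective u i j e)

unique-in-image-length≤ : ∀ {K} {B : Set} (ι : Fin K → B) (L : List B) → Unique L →
  All (λ b → ∃ λ k → ι k ≡ b) L → length L ≤ K
unique-in-image-length≤ ι L u inImage = injective⇒≤ {f = preimage} preimage-injective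
  where
  preimage : Fin (length L) → Fin _
  preimage j = proj₁ (All.lookup inImage (∈-lookup j))

  preimage-injective : ∀ {i j} → preimage i ≡ preimage j → i ≡ j
  preimage-injective {i} {j} e = unique-lookup-injective u i j (begin
    lookup L i          ≡⟨ sym (proj₂ (All.lookup inImage (∈-lookup i))) ⟩
    ι (preimage i)      ≡⟨ cong ι e ⟩
    ι (preimage j)      ≡⟨ proj₂ (All.lookup inImage (∈-lookup j)) ⟩
    lookup L j          ∎)
    where open ≡-Reasoning

count-in-image≤ : ∀ {K M} (ι : Fin K → Fin M) {P : Fin M → Set} (P? : Decidable P) →
  (∀ c → P c → ∃ λ k → ι k ≡ c) → length (filter P? (allFin M)) ≤ K
count-in-image≤ {M = M} ι P? inImage = unique-in-image-length≤ ι _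
  (filter⁺ P? (allFin⁺ M)) (All.map (λ {c} → inImage c) (all-filter P? (allFin M)))

two-witnesses : ∀ {m} {P : Fin m → Set} (P? : Decidable P) →
  2 ≤ length (filter P? (allFin m)) → Σ (Fin m) λ r → Σ (Fin m) λ r' → r ≢ r' × P r × P r'
two-witnesses {m} {P} P? = pick (filter⁺ P? (allFin⁺ m)) (all-filter P? (allFin m))
  where
  pick : ∀ {L} → Unique L → All P L → 2 ≤ length L → Σ (Fin m) λ r → Σ (Fin m) λ r' → r ≢ r' × P r × P r'
  pick {r ∷ r' ∷ _} ((r≢r' ∷ _) ∷ _) (Pr ∷ Pr' ∷ _) _ = r , r' , r≢r' , Pr , Pr'
  pick {_ ∷ []} _ _ (s≤s ())

column-in-subarray : ∀ {m n n'} {A : Array m n} → IsOA m n A → ((ι , S , _) : HasSubOA m n A n') →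
  ∀ {r r'} c → r ≢ r' → A r c ∈ₛ S r → A r' c ∈ₛ S r' → ∃ λ k → ι k ≡ c
column-in-subarray {A = A} oa (ι , S , _ , _ , _ , sub) {r} {r'} c r≢r' c∈S c∈S'
  with sub r r' r≢r' (A r c) (A r' c) c∈S c∈S'
... | k , ιk-has-pair , _ =
  let (_ , _ , unique-column) = oa r r' r≢r' (A r c) (A r' c)
  in k , trans (unique-column (ι k) ιk-has-pair) (sym (unique-column c (refl , refl)))

markedWeight : (m n n' : ℕ) → (Fin m → Subset n) → Weight m n
markedWeight m n n' S r i = - fromℕ n' +ℚ (fromℕ n when does (i ∈? S r))

markedWeight-total : ∀ {m n n'} (S : Fin m → Subset n) → (∀ r → ∣ S r ∣ ≡ n') →
  totalWeight m n (markedWeight m n n' S) ≡ 0ℚ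
markedWeight-total {m} {n} {n'} S card = sum-zero _ row-zero (allFin m)
  where
  open +-*-Solver
  row-zero : ∀ r → ΣFin n (markedWeight m n n' S r) ≡ 0ℚ
  row-zero r = begin
    ΣFin n (markedWeight m n n' S r)
      ≡⟨ sum-affine-indicator (_∈? S r) (- fromℕ n') (fromℕ n) (allFin n) ⟩
    fromℕ (length (allFin n)) *ℚ (- fromℕ n') +ℚ fromℕ (length (filter (_∈? S r) (allFin n))) *ℚ fromℕ n
      ≡⟨ cong₂ (λ a b → fromℕ a *ℚ (- fromℕ n') +ℚ fromℕ b *ℚ fromℕ n)
               (length-allFin n) (trans (count-∈ (S r)) (card r)) ⟩
    fromℕ n *ℚ (- fromℕ n') +ℚ fromℕ n' *ℚ fromℕ n
      ≡⟨ solve 2 (λ a b → a :* (:- b) :+ b :* a := con 0ℚ) refl (fromℕ n) (fromℕ n') ⟩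
    0ℚ ∎
    where open ≡-Reasoning

markedRows : ∀ {m n} → Array m n → (Fin m → Subset n) → Fin (n * n) → ℕ
markedRows {m} A S c = length (filter (λ r → A r c ∈? S r) (allFin m))

column-negative : ∀ {m n n'} (A : Array m n) (S : Fin m → Subset n) → n < m * n' →
  ∀ c → markedRows A S c ≤ 1 → columnWeight m n A (markedWeight m n n' S) c <ℚ 0ℚ
column-negative {m} {n} {n'} A S n<mn' c few = begin-strict
  columnWeight m n A (markedWeight m n n' S) c
    ≡⟨ sum-affine-indicator (λ r → A r c ∈? S r) (- fromℕ n') (fromℕ n) (allFin m) ⟩
  fromℕ (length (allFin m)) *ℚ (- fromℕ n') +ℚ fromℕ k *ℚ fromℕ n
    ≡⟨ cong₂ _+ℚ_ (cong (λ a → fromℕ a *ℚ (- fromℕ n')) (length-allFin m)) (sym (fromℕ-* k n)) ⟩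
  fromℕ m *ℚ (- fromℕ n') +ℚ fromℕ (k * n)
    <⟨ ℚP.+-monoʳ-< (fromℕ m *ℚ (- fromℕ n')) (fromℕ-mono-< kn<mn') ⟩
  fromℕ m *ℚ (- fromℕ n') +ℚ fromℕ (m * n')
    ≡⟨ cong (fromℕ m *ℚ (- fromℕ n') +ℚ_) (fromℕ-* m n') ⟩
  fromℕ m *ℚ (- fromℕ n') +ℚ fromℕ m *ℚ fromℕ n'
    ≡⟨ solve 2 (λ a b → a :* (:- b) :+ a :* b := con 0ℚ) refl (fromℕ m) (fromℕ n') ⟩
  0ℚ ∎
  where
  open ℚP.≤-Reasoning
  open +-*-Solver using (solve; _:*_; _:+_; :-_; _:=_; con)
  k = markedRows A S c
  kn<mn' : k * n < m * n'
  kn<mn' = ℕP.≤-<-trans (ℕP.≤-trans (ℕP.*-monoˡ-≤ n few) (ℕP.≤-reflexive (ℕP.+-identityʳ n))) n<mn'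

nonneg-column-in-subarray : ∀ {m n n'} {A : Array m n} → IsOA m n A →
  ((ι , S , _) : HasSubOA m n A n') → n < m * n' →
  ∀ c → 0ℚ ≤ℚ columnWeight m n A (markedWeight m n n' S) c → ∃ λ k → ι k ≡ c
nonneg-column-in-subarray {A = A} oa sub@(_ , S , _) n<mn' c nonneg with 2 ℕ.≤? markedRows A S c
... | yes two-marked =
  let (_ , _ , r≢r' , c∈S , c∈S') = two-witnesses (λ r → A r c ∈? S r) two-marked
  in column-in-subarray oa sub c r≢r' c∈S c∈S'
... | no ¬two-marked = ⊥-elim (ℚP.<-irrefl refl
  (ℚP.≤-<-trans nonneg (column-negative A S n<mn' c (ℕP.≤-pred (ℕP.≰⇒> ¬two-marked)))))

lemma13 : (m n n' : ℕ) (A : Array m n) → IsOA m n A →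
    HasSubOA m n A n' → n < m * n' → n' * n' < n →
    ¬ MMSStar m n A
lemma13 m n n' A oa sub@(ι , S , _ , card , _) n<mn' n'²<n mms =
  ℕP.<⇒≱ n'²<n (ℕP.≤-trans n≤nonneg nonneg≤n'²)
  where
  f : Weight m n
  f = markedWeight m n n' S

  n≤nonneg : n ≤ nonnegColumns m n A f
  n≤nonneg = mms f (markedWeight-total S card)

  nonneg≤n'² : nonnegColumns m n A f ≤ n' * n'
  nonneg≤n'² = count-in-image≤ ι (λ c → 0ℚ ℚP.≤? columnWeight m n A f c)
    (nonneg-column-in-subarray oa sub n<mn')
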